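{- Let $s\ge 1$ be an integer. If a graph $G$ is $(s,s-1)$-dismantlable, then $G$ does not contain finite locally $s$-isometric subgraphs.
   Context: Graphs are undirected, connected, simple, possibly infinite; $d$ is the shortest-path distance of $G$; $B_r(v,G)=\{x: d(v,x)\le r\}$ and $B_r(v,G-\{u\})$ is the ball around $v$ in $G$ with vertex $u$ deleted. For a well-order $\preceq$ on $V$, $X_v=\{w: w\preceq v\}$. $G$ is $(s,s')$-dismantlable if $V$ admits a well-order $\preceq$ such that for each vertex $v$ (other than the least element) there is $u\ne v$, $u\preceq v$, with $B_s(v,G-\{u\})\cap X_v\subseteq B_{s'}(u,G)$. A geodesic is a shortest path of $G$. A subgraph $H$ of $G$ is locally $s$-isometric if $H$ contains a collection $\mathcal P$ of geodesics of $G$ such that for every vertex $v$ of $H$ there is a geodesic $P\in\mathcal P$ passing through $v$ whose endvertices $x,y$ satisfy $d(v,x)\ge s$ and $d(v,y)\ge s$. -}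

module Defs where

open import Level using (Level; _⊔_) renaming (suc to lsuc)
open import Data.Nat using (ℕ; zero; suc; _<_; _≤_)
open import Data.Fin using (Fin; inject₁; fromℕ) renaming (zero to fzero; suc to fsuc)
open import Data.Product using (Σ; ∃; ∃-syntax; _×_; _,_)
open import Data.Sum using (_⊎_)
open import Data.List using (List)
open import Data.List.Membership.Propositional using (_∈_)
open import Relation.Nullary using (¬_)
open import Relation.Binary.PropositionalEquality using (_≡_; _≢_)
open import Induction.WellFounded using (WellFounded)

record Graph : Set₁ where
  field
    V     : Set
    E     : V → V → Set
    sym   : ∀ {x y} → E x y → E y x
    irrefl : ∀ {x} → ¬ E x x

module _ (G : Graph) where
  open Graph G

  data Walk : V → V → ℕ → Set where
    [] : ∀ {x} → Walk x x zero
    _∷_ : ∀ {x y z n} → E x y → Walk y z n → Walk x z (suc n)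

  -- Walks of length n from x to y all of whose vertices differ from u
  -- (i.e. walks in G - {u}).
  data WalkAvoid (u : V) : V → V → ℕ → Set where
    [] : ∀ {x} → x ≢ u → WalkAvoid u x x zero
    _∷_ : ∀ {x y z n} → x ≢ u → E x y → WalkAvoid u y z n → WalkAvoid u x z (suc n)

  Connected : Set
  Connected = ∀ x y → ∃[ n ] Walk x y n

  DistLe : V → V → ℕ → Set
  DistLe x y r = ∃[ n ] (n ≤ r × Walk x y n)

  DistGe : V → V → ℕ → Set
  DistGe x y r = ¬ (∃[ n ] (n < r × Walk x y n))

  InBall : ℕ → V → V → Set
  InBall r v x = DistLe v x r

  InBallMinus : ℕ → V → V → V → Set
  InBallMinus r u v x = ∃[ n ] (n ≤ r × WalkAvoid u v x n)

  record WellOrder : Set₁ where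
    field
      _≺_   : V → V → Set
      trans : ∀ {x y z} → x ≺ y → y ≺ z → x ≺ z
      total : ∀ x y → x ≺ y ⊎ x ≡ y ⊎ y ≺ x
      irr   : ∀ {x} → ¬ (x ≺ x)
      wf    : WellFounded _≺_

    _≼_ : V → V → Set
    x ≼ y = x ≺ y ⊎ x ≡ y

    InX : V → V → Set
    InX v w = w ≼ v

    Least : V → Set
    Least v = ∀ w → v ≼ w

  Dismantlable : ℕ → ℕ → Set₁
  Dismantlable s s' =
    Σ WellOrder λ O → let open WellOrder O in
      ∀ v → ¬ Least v →
        ∃[ u ] (u ≢ v × u ≼ v ×
          (∀ x → InBallMinus s u v x → InX v x → InBall s' u x))

  record Geodesic : Set where
    field
      len      : ℕ
      vert     : Fin (suc len) → V
      adj      : ∀ (i : Fin len) → E (vert (inject₁ i)) (vert (fsuc i))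
      shortest : DistGe (vert fzero) (vert (fromℕ len)) len

    start end : V
    start = vert fzero
    end   = vert (fromℕ len)

  record Subgraph : Set₁ where
    field
      HV  : V → Set
      HE  : V → V → Set
      HE⊆ : ∀ {x y} → HE x y → HV x × HV y × E x y

  -- A subgraph is finite if its vertex set is listed by a finite list;
  -- graphs have a nonempty vertex set.
  Finite : Subgraph → Set
  Finite H = ∃[ xs ] (∀ x → Subgraph.HV H x → x ∈ xs)

  Nonempty : Subgraph → Set
  Nonempty H = ∃[ x ] Subgraph.HV H x

  GeodesicIn : Subgraph → Geodesic → Set
  GeodesicIn H P =
    (∀ i → Subgraph.HV H (Geodesic.vert P i)) ×
    (∀ (i : Fin (Geodesic.len P)) →
       Subgraph.HE H (Geodesic.vert P (inject₁ i)) (Geodesic.vert P (fsuc i)))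

  PassesThrough : Geodesic → V → Set
  PassesThrough P v = ∃[ i ] Geodesic.vert P i ≡ v

  LocallyIsometric : ℕ → Subgraph → Set₁
  LocallyIsometric s H =
    Σ (Geodesic → Set) λ 𝒫 →
      (∀ P → 𝒫 P → GeodesicIn H P) ×
      (∀ v → Subgraph.HV H v →
        ∃[ P ] (𝒫 P × PassesThrough P v ×
                DistGe v (Geodesic.start P) s × DistGe v (Geodesic.end P) s))

-- Let v be the greatest vertex of H in the dismantling order and P ⊆ H a geodesic through v
-- whose ends are at distance ≥ s from v. Then v is not the least vertex, so some u ≠ v has
-- B_s(v, G - u) ∩ X_v ⊆ B_s'(u) with s' < s, and P ⊆ X_v. On each side of v, the subpath of P
-- of length s either contains u or avoids it, in which case its far end lies within s' of u.
-- Either way u is nearer to some vertex of P before v, and to some vertex after v, than their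
-- distances along P to v, so the walk between these two vertices through u shortcuts P.
module Submission where

open import Defs
open import Data.Nat using (ℕ; zero; suc; _+_; _∸_; _≤_; _<_; z≤n; s≤s)
open import Data.Nat.Properties
open import Data.Fin using (Fin; toℕ; inject₁; fromℕ<) renaming (zero to fzero; suc to fsuc)
open import Data.Fin.Properties using (toℕ-injective; toℕ≤pred[n]; toℕ-inject₁; toℕ-fromℕ<; toℕ-fromℕ)
open import Data.Product using (∃; ∃-syntax; _×_; _,_; proj₁)
open import Data.Sum using (_⊎_; inj₁; inj₂; [_,_]′)
open import Data.Empty using (⊥; ⊥-elim)
open import Data.List using (List; []; _∷_)
open import Data.List.Relation.Unary.Any using (here; there)
open import Data.List.Membership.Propositional using (_∈_; _∉_)
open import Function using (id)
open import Relation.Nullary using (¬_; Dec; yes; no)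
open import Relation.Nullary.Decidable using (¬¬-excluded-middle)
open import Relation.Nullary.Negation using (¬¬-Monad; ¬¬-map)
open import Relation.Binary.Definitions using (Total; Transitive)
open import Relation.Binary.PropositionalEquality
  using (_≡_; _≢_; refl; sym; trans; cong; subst; subst₂)
open import Effect.Monad using (RawMonad)
open import Level using (0ℓ)

open RawMonad (¬¬-Monad {a = 0ℓ}) using (return; _>>=_)

module _ {A : Set} {_≤ᴬ_ : A → A → Set} (total : Total _≤ᴬ_) (≤ᴬ-trans : Transitive _≤ᴬ_)
         (P : A → Set) where

  private
    GreatestOrAbsentIn : List A → Set
    GreatestOrAbsentIn ys =
      (∀ w → P w → w ∉ ys) ⊎ ∃[ v ] (P v × ∀ w → P w → w ∈ ys → w ≤ᴬ v)

    extend : ∀ {y ys} → Dec (P y) → GreatestOrAbsentIn ys → GreatestOrAbsentIn (y ∷ ys)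
    extend (no ¬Py) (inj₁ absent) =
      inj₁ λ { w Pw (here refl) → ¬Py Pw ; w Pw (there w∈ys) → absent w Pw w∈ys }
    extend (no ¬Py) (inj₂ (v , Pv , bound)) =
      inj₂ (v , Pv , λ { w Pw (here refl) → ⊥-elim (¬Py Pw) ; w Pw (there w∈ys) → bound w Pw w∈ys })
    extend {y} (yes Py) (inj₁ absent) =
      inj₂ (y , Py , λ { w Pw (here refl) → [ id , id ]′ (total y y)
                       ; w Pw (there w∈ys) → ⊥-elim (absent w Pw w∈ys) })
    extend {y} (yes Py) (inj₂ (v , Pv , bound)) with total y v
    ... | inj₁ y≤v = inj₂ (v , Pv , λ { w Pw (here refl) → y≤v ; w Pw (there w∈ys) → bound w Pw w∈ys })
    ... | inj₂ v≤y = inj₂ (y , Py , λ { w Pw (here refl) → [ id , id ]′ (total y y)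
                                      ; w Pw (there w∈ys) → ≤ᴬ-trans (bound w Pw w∈ys) v≤y })

    ¬¬-greatest-or-absent : ∀ ys → ¬ ¬ GreatestOrAbsentIn ys
    ¬¬-greatest-or-absent [] = return (inj₁ λ _ _ ())
    ¬¬-greatest-or-absent (y ∷ ys) = do
      r ← ¬¬-greatest-or-absent ys
      d ← ¬¬-excluded-middle
      return (extend d r)

  ¬¬-greatest : (ys : List A) → (∀ w → P w → w ∈ ys) → ∃ P →
                ¬ ¬ (∃[ v ] (P v × ∀ w → P w → w ≤ᴬ v))
  ¬¬-greatest ys P⊆ys (x , Px) = ¬¬-map greatest (¬¬-greatest-or-absent ys)
    where
    greatest : GreatestOrAbsentIn ys → ∃[ v ] (P v × ∀ w → P w → w ≤ᴬ v)
    greatest (inj₁ absent) = ⊥-elim (absent x Px (P⊆ys x Px))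
    greatest (inj₂ (v , Pv , bound)) = v , Pv , λ w Pw → bound w Pw (P⊆ys w Pw)

module _ {G : Graph} (O : WellOrder G) where
  open WellOrder O renaming (trans to ≺-trans)

  ≼-trans : Transitive _≼_
  ≼-trans (inj₁ x≺y) (inj₁ y≺z) = inj₁ (≺-trans x≺y y≺z)
  ≼-trans (inj₁ x≺y) (inj₂ refl) = inj₁ x≺y
  ≼-trans (inj₂ refl) y≼z = y≼z

  ≼-total : Total _≼_
  ≼-total x y with total x y
  ... | inj₁ x≺y = inj₁ (inj₁ x≺y)
  ... | inj₂ (inj₁ x≡y) = inj₁ (inj₂ x≡y)
  ... | inj₂ (inj₂ y≺x) = inj₂ (inj₁ y≺x)

  ≼-antisym : ∀ {x y} → x ≼ y → y ≼ x → x ≡ y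
  ≼-antisym (inj₂ x≡y) _ = x≡y
  ≼-antisym (inj₁ _) (inj₂ y≡x) = sym y≡x
  ≼-antisym (inj₁ x≺y) (inj₁ y≺x) = ⊥-elim (irr (≺-trans x≺y y≺x))

module _ {G : Graph} where
  open Graph G renaming (sym to E-sym)

  Walk-snoc : ∀ {x y z n} → Walk G x y n → E y z → Walk G x z (suc n)
  Walk-snoc [] e = e ∷ []
  Walk-snoc (e′ ∷ w) e = e′ ∷ Walk-snoc w e

  Walk-reverse : ∀ {x y n} → Walk G x y n → Walk G y x n
  Walk-reverse [] = []
  Walk-reverse (e ∷ w) = Walk-snoc (Walk-reverse w) (E-sym e)

  _++ʷ_ : ∀ {x y z m n} → Walk G x y m → Walk G y z n → Walk G x z (m + n)
  [] ++ʷ w′ = w′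
  (e ∷ w) ++ʷ w′ = e ∷ (w ++ʷ w′)

  WalkAvoid-snoc : ∀ {u x y z n} → WalkAvoid G u x y n → E y z → z ≢ u → WalkAvoid G u x z (suc n)
  WalkAvoid-snoc ([] x≢u) e z≢u = _∷_ x≢u e ([] z≢u)
  WalkAvoid-snoc (_∷_ x≢u e′ w) e z≢u = _∷_ x≢u e′ (WalkAvoid-snoc w e z≢u)

  WalkAvoid-reverse : ∀ {u x y n} → WalkAvoid G u x y n → WalkAvoid G u y x n
  WalkAvoid-reverse ([] x≢u) = [] x≢u
  WalkAvoid-reverse (_∷_ x≢u e w) = WalkAvoid-snoc (WalkAvoid-reverse w) (E-sym e) x≢u

clamp : ℕ → (L : ℕ) → Fin (suc L)
clamp zero L = fzero
clamp (suc n) zero = fzero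
clamp (suc n) (suc L) = fsuc (clamp n L)

toℕ-clamp : ∀ {n L} → n ≤ L → toℕ (clamp n L) ≡ n
toℕ-clamp {zero} z≤n = refl
toℕ-clamp {suc n} (s≤s n≤L) = cong suc (toℕ-clamp n≤L)

module _ {G : Graph} (P : Geodesic G) where
  open Graph G using (V; E)
  open Geodesic P

  -- The vertex of P at distance n from its start, clamped to the last vertex for n > len.
  at : ℕ → V
  at n = vert (clamp n len)

  vert≡at : ∀ i → vert i ≡ at (toℕ i)
  vert≡at i = cong vert (toℕ-injective (sym (toℕ-clamp (toℕ≤pred[n] i))))

  at-len : at len ≡ end
  at-len = cong vert (toℕ-injective (trans (toℕ-clamp ≤-refl) (sym (toℕ-fromℕ len))))

  at-edge : ∀ n → suc n ≤ len → E (at n) (at (suc n))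
  at-edge n n<len = subst₂ E
    (trans (vert≡at (inject₁ j)) (cong at (trans (toℕ-inject₁ j) (toℕ-fromℕ< n<len))))
    (trans (vert≡at (fsuc j)) (cong (λ k → at (suc k)) (toℕ-fromℕ< n<len)))
    (adj j)
    where j = fromℕ< n<len

  segment : ∀ {α β} m → m + α ≡ β → β ≤ len → Walk G (at α) (at β) m
  segment zero refl _ = []
  segment {α} (suc m) refl β≤len = Walk-snoc (segment m refl (<⇒≤ β≤len)) (at-edge (m + α) β≤len)

  MeetsOrAvoids : V → ℕ → ℕ → ℕ → Set
  MeetsOrAvoids u α β m = (∃[ t ] (t ≤ m × at (t + α) ≡ u)) ⊎ WalkAvoid G u (at α) (at β) m

  ¬¬-meets-or-avoids : ∀ u {α β} m → m + α ≡ β → β ≤ len → ¬ ¬ MeetsOrAvoids u α β m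
  ¬¬-meets-or-avoids u {α} zero refl _ = do
    d ← ¬¬-excluded-middle
    return (decide d)
    where
    decide : Dec (at α ≡ u) → MeetsOrAvoids u α α 0
    decide (yes meets) = inj₁ (0 , z≤n , meets)
    decide (no avoids) = inj₂ ([] avoids)
  ¬¬-meets-or-avoids u {α} (suc m) refl β≤len = do
    r ← ¬¬-meets-or-avoids u m refl (<⇒≤ β≤len)
    d ← ¬¬-excluded-middle
    return (extend r d)
    where
    extend : MeetsOrAvoids u α (m + α) m → Dec (at (suc m + α) ≡ u) →
             MeetsOrAvoids u α (suc m + α) (suc m)
    extend (inj₁ (t , t≤m , meets)) _ = inj₁ (t , m≤n⇒m≤1+n t≤m , meets)
    extend (inj₂ _) (yes meets) = inj₁ (suc m , ≤-refl , meets)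
    extend (inj₂ w) (no avoids) = inj₂ (WalkAvoid-snoc w (at-edge (m + α) β≤len) avoids)

  geodesic-no-shortcut : ∀ {α β n} → β ≤ len → Walk G (at α) (at β) n → ¬ (n + α < β)
  geodesic-no-shortcut {α} {β} {n} β≤len w n+α<β with m≤n⇒∃[o]m+o≡n β≤len
  ... | d , β+d≡len =
    shortest (α + (n + d) , shorter , subst (λ x → Walk G start x (α + (n + d))) at-len through-w)
    where
    α≤len : α ≤ len
    α≤len = ≤-trans (m≤n+m α n) (≤-trans (<⇒≤ n+α<β) β≤len)
    through-w : Walk G (at 0) (at len) (α + (n + d))
    through-w = segment α (+-identityʳ α) α≤len
             ++ʷ (w ++ʷ segment d (trans (+-comm d β) β+d≡len) ≤-refl)
    shorter : α + (n + d) < len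
    shorter = begin-strict
      α + (n + d)  ≡⟨ sym (+-assoc α n d) ⟩
      (α + n) + d  ≡⟨ cong (_+ d) (+-comm α n) ⟩
      (n + α) + d  <⟨ +-monoˡ-< d n+α<β ⟩
      β + d        ≡⟨ β+d≡len ⟩
      len          ∎
      where open ≤-Reasoning

  far-from-start : ∀ {s c} → c ≤ len → DistGe G (at c) start s → s ≤ c
  far-from-start {c = c} c≤len far =
    ≮⇒≥ λ c<s → far (c , c<s , Walk-reverse (segment c (+-identityʳ c) c≤len))

  far-from-end : ∀ {s c} → c ≤ len → DistGe G (at c) end s → s + c ≤ len
  far-from-end {s} {c} c≤len far with m≤n⇒∃[o]m+o≡n c≤len
  ... | d , c+d≡len = subst (s + c ≤_) d+c≡len (+-monoˡ-≤ c s≤d)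
    where
    d+c≡len : d + c ≡ len
    d+c≡len = trans (+-comm d c) c+d≡len
    s≤d : s ≤ d
    s≤d = ≮⇒≥ λ d<s →
      far (d , d<s , subst (λ x → Walk G (at c) x d) at-len (segment d d+c≡len ≤-refl))

  module _ {s r} (r<s : r < s) {c} (s+c≤len : s + c ≤ len) (u : V) (u≢v : u ≢ at c)
           (ball : ∀ k → InBallMinus G s u (at c) (at k) → DistLe G u (at k) r) where

    private
      c≤len : c ≤ len
      c≤len = ≤-trans (m≤n+m c s) s+c≤len

    ¬¬-reach-below : ∀ {a} → s + a ≡ c → ¬ ¬ (∃[ α ] ∃[ n ] (Walk G (at α) u n × n + α < c))
    ¬¬-reach-below {a} s+a≡c = ¬¬-map reach (¬¬-meets-or-avoids u s s+a≡c c≤len)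
      where
      reach : MeetsOrAvoids u a c s → ∃[ α ] ∃[ n ] (Walk G (at α) u n × n + α < c)
      reach (inj₁ (t , t≤s , meets)) =
        t + a , 0 , subst (λ x → Walk G (at (t + a)) x 0) meets [] ,
        subst (t + a <_) s+a≡c (+-monoˡ-< a t<s)
        where
        t<s : t < s
        t<s = ≤∧≢⇒< t≤s λ { refl → u≢v (trans (sym meets) (cong at s+a≡c)) }
      reach (inj₂ avoids) with ball a (s , ≤-refl , WalkAvoid-reverse avoids)
      ... | n , n≤r , w =
        a , n , Walk-reverse w , subst (n + a <_) s+a≡c (+-monoˡ-< a (≤-<-trans n≤r r<s))

    ¬¬-reach-above : ¬ ¬ (∃[ β ] ∃[ n ] (Walk G u (at β) n × n + c < β × β ≤ len))
    ¬¬-reach-above = ¬¬-map reach (¬¬-meets-or-avoids u s refl s+c≤len)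
      where
      reach : MeetsOrAvoids u c (s + c) s → ∃[ β ] ∃[ n ] (Walk G u (at β) n × n + c < β × β ≤ len)
      reach (inj₁ (t , t≤s , meets)) =
        t + c , 0 , subst (λ x → Walk G x (at (t + c)) 0) meets [] ,
        +-monoˡ-< c (n≢0⇒n>0 λ { refl → u≢v (sym meets) }) , ≤-trans (+-monoˡ-≤ c t≤s) s+c≤len
      reach (inj₂ avoids) with ball (s + c) (s , ≤-refl , avoids)
      ... | n , n≤r , w = s + c , n , w , +-monoˡ-< c (≤-<-trans n≤r r<s) , s+c≤len

    geodesic-blocks-dismantling : s ≤ c → ⊥
    geodesic-blocks-dismantling s≤c with m≤n⇒∃[o]m+o≡n s≤c
    ... | a , s+a≡c =
      ¬¬-reach-below s+a≡c λ (α , m , w₁ , m+α<c) →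
      ¬¬-reach-above λ (β , n , w₂ , n+c<β , β≤len) →
      geodesic-no-shortcut β≤len (w₁ ++ʷ w₂) (begin-strict
        (m + n) + α  ≡⟨ cong (_+ α) (+-comm m n) ⟩
        (n + m) + α  ≡⟨ +-assoc n m α ⟩
        n + (m + α)  <⟨ +-monoʳ-< n m+α<c ⟩
        n + c        <⟨ n+c<β ⟩
        β            ∎)
      where open ≤-Reasoning

dismantlable⇒¬locally-isometric : ∀ {s s′} → s′ < s → (G : Graph) → Dismantlable G s s′ →
  (H : Subgraph G) → Finite G H → Nonempty G H → ¬ LocallyIsometric G s H
dismantlable⇒¬locally-isometric s′<s G (O , dismantle) H (xs , H⊆xs) nonempty (𝒫 , 𝒫⊆H , cover) =
  ¬¬-greatest (≼-total O) (≼-trans O) HV xs H⊆xs nonempty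
    λ (v , v∈H , greatest) → greatest-not-dismantled v v∈H greatest
  where
  open WellOrder O using (_≼_; Least)
  open Subgraph H using (HV)

  greatest-not-dismantled : ∀ v → HV v → (∀ w → HV w → w ≼ v) → ⊥
  greatest-not-dismantled v v∈H greatest with cover v v∈H
  ... | P , P∈𝒫 , (i , refl) , far-start , far-end with dismantle (vert i) not-least
    where
    open Geodesic P
    not-least : ¬ Least (vert i)
    not-least least = far-start
      (0 , ≤-trans (s≤s z≤n) s′<s ,
       subst (λ x → Walk G (vert i) x 0)
             (≼-antisym O (least start) (greatest start (proj₁ (𝒫⊆H P P∈𝒫) fzero))) [])
  ... | u , u≢v , _ , ball rewrite vert≡at P i =
    geodesic-blocks-dismantling P s′<s (far-from-end P c≤len far-end) u u≢v
      (λ k u∈B → ball (at P k) u∈B (greatest (at P k) (proj₁ (𝒫⊆H P P∈𝒫) _)))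
      (far-from-start P c≤len far-start)
    where
    c≤len : toℕ i ≤ Geodesic.len P
    c≤len = toℕ≤pred[n] i

lemma3 : (s : ℕ) → 1 ≤ s → (G : Graph) → Connected G →
         Dismantlable G s (s ∸ 1) →
         (H : Subgraph G) → Finite G H → Nonempty G H →
         ¬ LocallyIsometric G s H
lemma3 s 1≤s G _ = dismantlable⇒¬locally-isometric (∸-monoʳ-< (s≤s z≤n) 1≤s) G
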